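{- Let $\{V_n\}_{n\ge 0}$ be the Fennessey-Larcombe-French sequence, defined by $V_0=1$, $V_1=8$ and, for $n\ge 2$, $$(n-1)n^2 V_n = 8(n-1)(3n^2-n-1)V_{n-1} - 128(n-2)n^2 V_{n-2}.$$ Then the sequence $\{V_n^2 - V_{n-1}V_{n+1}\}_{n\ge 2}$ is strictly log-convex, that is, for all integers $n\ge 3$, $$(V_n^2 - V_{n-1}V_{n+1})^2 < (V_{n-1}^2 - V_{n-2}V_n)(V_{n+1}^2 - V_nV_{n+2}).$$
   Context: A real sequence $\{S_n\}$ is strictly log-convex if $S_n^2 < S_{n-1}S_{n+1}$ for all admissible $n$. -}

module Defs where

open import Data.Nat as ℕ using (ℕ; zero; suc)
open import Data.Integer as ℤ using (ℤ; +_)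
open import Data.Rational using (ℚ; _/_; _*_; _-_; _+_)
open import Data.Product using (_×_; _,_; proj₁)

-- Denominator (n-1) n^2 of the recurrence, for n = m + 2, i.e. (m+1)(m+2)^2.
den : ℕ → ℕ
den m = suc m ℕ.* (suc (suc m) ℕ.* suc (suc m))

ι : ℕ → ℚ
ι n = (+ n) / 1

-- Step for n = m + 2, given (V_{n-2}, V_{n-1}), computes V_n from
-- (n-1) n^2 V_n = 8 (n-1)(3n^2 - n - 1) V_{n-1} - 128 (n-2) n^2 V_{n-2}.
step : ℕ → ℚ → ℚ → ℚ
step m a b =
  let n = suc (suc m) in
  ((+ 1) / den m) *
    ( ι 8 * ι (suc m) * (ι 3 * ι n * ι n - ι n - ι 1) * b
    - ι 128 * ι m * ι n * ι n * a )

Vpair : ℕ → ℚ × ℚ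
Vpair zero = ι 1 , ι 8
Vpair (suc n) with Vpair n
... | (a , b) = b , step n a b

V : ℕ → ℚ
V n = proj₁ (Vpair n)

-- Let M k = k⁵ and L k = 16 (k⁵ + k² + 6). For k ≥ 7 the ratio V (k + 1) / V k is at least L k / M k:
-- this holds at k = 7 and propagates by induction. Fix such a k and put p = V k and
-- s = M k V (k + 1) − L k V k ≥ 0. After scaling by positive polynomials in k, the recurrence makes every
-- V (k + i) a linear form in p and s, hence every V (k+i+1)² − V (k+i) V (k+i+2) a quadratic form, and a
-- positive multiple of the log-convexity defect a binary quartic form in p and s. All coefficients that occur
-- are polynomials in k whose coefficients in powers of k − 7 are nonnegative (and, where strictness is needed,
-- positive), which is checked by normalising them. The cases 3 ≤ n ≤ 8 are evaluated directly.

module Submission where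

open import Defs

-- A separate module keeps ℚ's _+_ out of the scope of the statement, which uses ℕ's.
module FennesseyLarcombeFrench where

  open import Data.Nat as ℕ using (ℕ; zero; suc)
  import Data.Nat.Properties as ℕ
  open import Data.Integer as ℤ using (ℤ; +_; 0ℤ; 1ℤ)
  import Data.Integer.Properties as ℤ
  import Data.Nat.Coprimality as Coprime
  open import Data.List using (List; []; _∷_)
  open import Data.List.Relation.Unary.All using (All; []; _∷_; all?)
  open import Data.Product using (_×_; _,_; proj₁; proj₂)
  open import Data.Rational
    using (ℚ; mkℚ; 0ℚ; 1ℚ; _/_; _+_; _*_; _-_; -_; _≤_; _<_; _≤?_; _<?_; positive; nonNegative)
  open import Data.Rational.Properties
    using ( ↥p/↧p≡p; normalize-coprime; normalize-nonNeg; normalize-pos; nonNegative⁻¹; positive⁻¹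
          ; ≤-refl; <⇒≤; <-≤-trans; +-mono-≤; +-mono-<-≤; +-monoʳ-≤; +-monoʳ-<; +-monoˡ-≤
          ; +-identityˡ; +-identityʳ; +-inverseʳ; *-assoc; *-identityˡ; *-inverseʳ; *-zeroˡ; *-zeroʳ
          ; nonNeg*nonNeg⇒nonNeg; pos*pos⇒pos; *-cancelˡ-≤-pos; *-cancelˡ-<-nonNeg )
  open import Data.Rational.Solver using (module +-*-Solver)
  open +-*-Solver using (solve; _:=_; con; _:+_; _:-_; _:*_)
  open import Relation.Binary.PropositionalEquality
    using (_≡_; refl; sym; trans; cong; cong₂; subst; subst₂; module ≡-Reasoning)
  open import Relation.Nullary.Decidable using (True; toWitness)

  open ≡-Reasoning

  *-nonNeg : ∀ {p q} → 0ℚ ≤ p → 0ℚ ≤ q → 0ℚ ≤ p * q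
  *-nonNeg {p} {q} 0≤p 0≤q =
    nonNegative⁻¹ _ {{nonNeg*nonNeg⇒nonNeg p {{nonNegative 0≤p}} q {{nonNegative 0≤q}}}}

  *-pos : ∀ {p q} → 0ℚ < p → 0ℚ < q → 0ℚ < p * q
  *-pos {p} {q} 0<p 0<q = positive⁻¹ _ {{pos*pos⇒pos p {{positive 0<p}} q {{positive 0<q}}}}

  *-cancelˡ-nonNeg : ∀ {p q} → 0ℚ < p → 0ℚ ≤ p * q → 0ℚ ≤ q
  *-cancelˡ-nonNeg {p} {q} 0<p 0≤pq =
    *-cancelˡ-≤-pos p {{positive 0<p}} (subst (_≤ p * q) (sym (*-zeroʳ p)) 0≤pq)

  *-cancelˡ-pos : ∀ {p q} → 0ℚ < p → 0ℚ < p * q → 0ℚ < q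
  *-cancelˡ-pos {p} {q} 0<p 0<pq =
    *-cancelˡ-<-nonNeg p {{nonNegative (<⇒≤ 0<p)}} (subst (_< p * q) (sym (*-zeroʳ p)) 0<pq)

  private
    p+[q-p]≡q : ∀ p q → p + (q - p) ≡ q
    p+[q-p]≡q = solve 2 (λ p q → p :+ (q :- p) := q) refl

  p≤q⇒0≤q-p : ∀ {p q} → p ≤ q → 0ℚ ≤ q - p
  p≤q⇒0≤q-p {p} {q} p≤q = subst (_≤ q - p) (+-inverseʳ p) (+-monoˡ-≤ (- p) p≤q)

  0≤q-p⇒p≤q : ∀ {p q} → 0ℚ ≤ q - p → p ≤ q
  0≤q-p⇒p≤q {p} {q} 0≤q-p = subst₂ _≤_ (+-identityʳ p) (p+[q-p]≡q p q) (+-monoʳ-≤ p 0≤q-p)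

  0<q-p⇒p<q : ∀ {p q} → 0ℚ < q - p → p < q
  0<q-p⇒p<q {p} {q} 0<q-p = subst₂ _<_ (+-identityʳ p) (p+[q-p]≡q p q) (+-monoʳ-< p 0<q-p)

  fromℤ : ℤ → ℚ
  fromℤ z = z / 1

  private
    fromℤ≡mkℚ : ∀ z → fromℤ z ≡ mkℚ z 0 (Coprime.sym (Coprime.1-coprimeTo _))
    fromℤ≡mkℚ z = ↥p/↧p≡p (mkℚ z 0 (Coprime.sym (Coprime.1-coprimeTo _)))

  fromℤ-+ : ∀ a b → fromℤ (a ℤ.+ b) ≡ fromℤ a + fromℤ b
  fromℤ-+ a b rewrite fromℤ≡mkℚ a | fromℤ≡mkℚ b =
    cong fromℤ (sym (cong₂ ℤ._+_ (ℤ.*-identityʳ a) (ℤ.*-identityʳ b)))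

  fromℤ-* : ∀ a b → fromℤ (a ℤ.* b) ≡ fromℤ a * fromℤ b
  fromℤ-* a b rewrite fromℤ≡mkℚ a | fromℤ≡mkℚ b = refl

  ι-+ : ∀ m n → ι (m ℕ.+ n) ≡ ι m + ι n
  ι-+ m n = trans (cong fromℤ (ℤ.pos-+ m n)) (fromℤ-+ (+ m) (+ n))

  ι-* : ∀ m n → ι (m ℕ.* n) ≡ ι m * ι n
  ι-* m n = trans (cong fromℤ (ℤ.pos-* m n)) (fromℤ-* (+ m) (+ n))

  0≤ι : ∀ n → 0ℚ ≤ ι n
  0≤ι n = nonNegative⁻¹ _ {{normalize-nonNeg n 1}}

  0<ι : ∀ n → 0ℚ < ι (suc n)
  0<ι n = positive⁻¹ _ {{normalize-pos (suc n) 1}}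

  ι[n]*[1/n]≡1 : ∀ n → ι (suc n) * ((+ 1) / suc n) ≡ 1ℚ
  ι[n]*[1/n]≡1 n =
    trans (cong₂ _*_ (fromℤ≡mkℚ (+ suc n)) (normalize-coprime (Coprime.1-coprimeTo (suc n))))
          (*-inverseʳ (mkℚ (+ suc n) 0 (Coprime.sym (Coprime.1-coprimeTo _))))

  Coeffs : Set
  Coeffs = List ℤ

  eval : Coeffs → ℚ → ℚ
  eval []       x = 0ℚ
  eval (c ∷ cs) x = fromℤ c + x * eval cs x

  infixl 6 _⊞_
  infixl 7 _⊠_

  _⊞_ : Coeffs → Coeffs → Coeffs
  []       ⊞ ds       = ds
  (c ∷ cs) ⊞ []       = c ∷ cs
  (c ∷ cs) ⊞ (d ∷ ds) = (c ℤ.+ d) ∷ (cs ⊞ ds)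

  scale : ℤ → Coeffs → Coeffs
  scale a []       = []
  scale a (c ∷ cs) = (a ℤ.* c) ∷ scale a cs

  _⊠_ : Coeffs → Coeffs → Coeffs
  []       ⊠ ds = []
  (c ∷ cs) ⊠ ds = scale c ds ⊞ (0ℤ ∷ (cs ⊠ ds))

  module _ (x : ℚ) where

    eval-⊞ : ∀ cs ds → eval (cs ⊞ ds) x ≡ eval cs x + eval ds x
    eval-⊞ []       ds       = sym (+-identityˡ _)
    eval-⊞ (c ∷ cs) []       = sym (+-identityʳ _)
    eval-⊞ (c ∷ cs) (d ∷ ds) rewrite fromℤ-+ c d | eval-⊞ cs ds =
      solve 5 (λ c d x e f → (c :+ d) :+ x :* (e :+ f) := (c :+ x :* e) :+ (d :+ x :* f)) refl
        (fromℤ c) (fromℤ d) x (eval cs x) (eval ds x)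

    eval-scale : ∀ a cs → eval (scale a cs) x ≡ fromℤ a * eval cs x
    eval-scale a []       = sym (*-zeroʳ (fromℤ a))
    eval-scale a (c ∷ cs) rewrite fromℤ-* a c | eval-scale a cs =
      solve 4 (λ a c x e → a :* c :+ x :* (a :* e) := a :* (c :+ x :* e)) refl
        (fromℤ a) (fromℤ c) x (eval cs x)

    eval-⊠ : ∀ cs ds → eval (cs ⊠ ds) x ≡ eval cs x * eval ds x
    eval-⊠ []       ds = sym (*-zeroˡ (eval ds x))
    eval-⊠ (c ∷ cs) ds rewrite eval-⊞ (scale c ds) (0ℤ ∷ (cs ⊠ ds)) | eval-scale c ds | eval-⊠ cs ds =
      solve 4 (λ c d x e → c :* d :+ (con 0ℚ :+ x :* (e :* d)) := (c :+ x :* e) :* d) refl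
        (fromℤ c) (eval ds x) x (eval cs x)

  NonNegCoeffs : Coeffs → Set
  NonNegCoeffs = All (0ℤ ℤ.≤_)

  eval-nonNeg : ∀ {cs x} → 0ℚ ≤ x → NonNegCoeffs cs → 0ℚ ≤ eval cs x
  eval-nonNeg 0≤x []                     = ≤-refl
  eval-nonNeg 0≤x (ℤ.+≤+ {n = c} _ ∷ cs) = +-mono-≤ (0≤ι c) (*-nonNeg 0≤x (eval-nonNeg 0≤x cs))

  infixl 6 _⊕_ _⊖_
  infixl 7 _⊗_

  data Expr : Set where
    lit         : ℕ → Expr
    X+_         : ℕ → Expr
    _⊕_ _⊖_ _⊗_ : Expr → Expr → Expr

  ⟦_⟧ : Expr → ℕ → ℚ
  ⟦ lit c ⟧ m = ι c
  ⟦ X+ c  ⟧ m = ι (c ℕ.+ m)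
  ⟦ e ⊕ f ⟧ m = ⟦ e ⟧ m + ⟦ f ⟧ m
  ⟦ e ⊖ f ⟧ m = ⟦ e ⟧ m - ⟦ f ⟧ m
  ⟦ e ⊗ f ⟧ m = ⟦ e ⟧ m * ⟦ f ⟧ m

  normalise : ℕ → Expr → Coeffs
  normalise b (lit c) = + c ∷ []
  normalise b (X+ c)  = + (c ℕ.+ b) ∷ + 1 ∷ []
  normalise b (e ⊕ f) = normalise b e ⊞ normalise b f
  normalise b (e ⊖ f) = normalise b e ⊞ scale (ℤ.- 1ℤ) (normalise b f)
  normalise b (e ⊗ f) = normalise b e ⊠ normalise b f

  eval-normalise : ∀ b e j → eval (normalise b e) (ι j) ≡ ⟦ e ⟧ (b ℕ.+ j)
  eval-normalise b (lit c) j = trans (cong (_+_ (ι c)) (*-zeroʳ (ι j))) (+-identityʳ (ι c))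
  eval-normalise b (X+ c)  j = begin
    ι (c ℕ.+ b) + ι j * (ι 1 + ι j * 0ℚ)
      ≡⟨ solve 2 (λ c y → c :+ y :* (con (ι 1) :+ y :* con 0ℚ) := c :+ y) refl (ι (c ℕ.+ b)) (ι j) ⟩
    ι (c ℕ.+ b) + ι j ≡⟨ ι-+ (c ℕ.+ b) j ⟨
    ι (c ℕ.+ b ℕ.+ j) ≡⟨ cong ι (ℕ.+-assoc c b j) ⟩
    ι (c ℕ.+ (b ℕ.+ j)) ∎
  eval-normalise b (e ⊕ f) j = trans (eval-⊞ (ι j) (normalise b e) (normalise b f))
                                     (cong₂ _+_ (eval-normalise b e j) (eval-normalise b f j))
  eval-normalise b (e ⊖ f) j = begin
    eval (ne ⊞ scale (ℤ.- 1ℤ) nf) y        ≡⟨ eval-⊞ y ne (scale (ℤ.- 1ℤ) nf) ⟩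
    eval ne y + eval (scale (ℤ.- 1ℤ) nf) y ≡⟨ cong (_+_ (eval ne y)) (eval-scale y (ℤ.- 1ℤ) nf) ⟩
    eval ne y + fromℤ (ℤ.- 1ℤ) * eval nf y
      ≡⟨ solve 2 (λ u w → u :+ con (fromℤ (ℤ.- 1ℤ)) :* w := u :- w) refl (eval ne y) (eval nf y) ⟩
    eval ne y - eval nf y                  ≡⟨ cong₂ _-_ (eval-normalise b e j) (eval-normalise b f j) ⟩
    ⟦ e ⊖ f ⟧ (b ℕ.+ j)                    ∎
    where y = ι j; ne = normalise b e; nf = normalise b f
  eval-normalise b (e ⊗ f) j = trans (eval-⊠ (ι j) (normalise b e) (normalise b f))
                                     (cong₂ _*_ (eval-normalise b e j) (eval-normalise b f j))

  -- e has nonnegative coefficients as a polynomial in X - b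
  NonNegCoeffsFrom : ℕ → Expr → Set
  NonNegCoeffsFrom b e = True (all? (0ℤ ℤ.≤?_) (normalise b e))

  nonNeg-by-coeffs : ∀ b e → NonNegCoeffsFrom b e → ∀ {m} → b ℕ.≤ m → 0ℚ ≤ ⟦ e ⟧ m
  nonNeg-by-coeffs b e ok {m} b≤m = subst (λ n → 0ℚ ≤ ⟦ e ⟧ n) (ℕ.m+[n∸m]≡n b≤m)
    (subst (0ℚ ≤_) (eval-normalise b e (m ℕ.∸ b)) (eval-nonNeg (0≤ι (m ℕ.∸ b)) (toWitness ok)))

  pos-by-coeffs : ∀ b e → NonNegCoeffsFrom b (e ⊖ lit 1) → ∀ {m} → b ℕ.≤ m → 0ℚ < ⟦ e ⟧ m
  pos-by-coeffs b e ok b≤m = <-≤-trans (0<ι 0) (0≤q-p⇒p≤q (nonNeg-by-coeffs b (e ⊖ lit 1) ok b≤m))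

  -- Aₑ c is the coefficient A of the recurrence at X + c, and so on.

  Aₑ Bₑ Dₑ Mₑ Lₑ : ℕ → Expr
  Aₑ c = lit 8 ⊗ X+ (suc c) ⊗ (lit 3 ⊗ X+ (suc (suc c)) ⊗ X+ (suc (suc c)) ⊖ X+ (suc (suc c)) ⊖ lit 1)
  Bₑ c = lit 128 ⊗ X+ c ⊗ X+ (suc (suc c)) ⊗ X+ (suc (suc c))
  Dₑ c = X+ (suc c) ⊗ (X+ (suc (suc c)) ⊗ X+ (suc (suc c)))
  Mₑ c = X+ c ⊗ X+ c ⊗ X+ c ⊗ X+ c ⊗ X+ c
  Lₑ c = lit 16 ⊗ (Mₑ c ⊕ X+ c ⊗ X+ c ⊕ lit 6)

  A B D M L : ℕ → ℚ
  A = ⟦ Aₑ 0 ⟧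
  B = ⟦ Bₑ 0 ⟧
  D = ⟦ Dₑ 0 ⟧
  M = ⟦ Mₑ 0 ⟧
  L = ⟦ Lₑ 0 ⟧

  recurrence : ∀ m → D m * V (2 ℕ.+ m) ≡ A m * V (1 ℕ.+ m) - B m * V m
  recurrence m = begin
    D m * ((+ 1) / den m * rhs)       ≡⟨ *-assoc (D m) ((+ 1) / den m) rhs ⟨
    D m * ((+ 1) / den m) * rhs       ≡⟨ cong (λ d → d * ((+ 1) / den m) * rhs) D≡ι[den] ⟩
    ι (den m) * ((+ 1) / den m) * rhs ≡⟨ cong (_* rhs) (ι[n]*[1/n]≡1 (ℕ.pred (den m))) ⟩
    1ℚ * rhs                          ≡⟨ *-identityˡ rhs ⟩
    rhs                               ∎
    where
    rhs = A m * V (1 ℕ.+ m) - B m * V m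
    n = suc (suc m)
    D≡ι[den] : D m ≡ ι (den m)
    D≡ι[den] = begin
      ι (suc m) * (ι n * ι n) ≡⟨ cong (ι (suc m) *_) (ι-* n n) ⟨
      ι (suc m) * ι (n ℕ.* n) ≡⟨ ι-* (suc m) (n ℕ.* n) ⟨
      ι (den m)               ∎

  quadratic : ℚ → ℚ → ℚ → ℚ → ℚ → ℚ
  quadratic α β γ p s = α * p * p + β * p * s + γ * s * s

  quartic : ℚ → ℚ → ℚ → ℚ → ℚ → ℚ → ℚ → ℚ
  quartic f₀ f₁ f₂ f₃ f₄ p s =
    f₀ * (p * p * p * p) + f₁ * (p * p * p * s) + f₂ * (p * p * s * s)
      + f₃ * (p * s * s * s) + f₄ * (s * s * s * s)

  module Coordinates (p s : ℚ) where

    record Coords (κ x a b : ℚ) : Set where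
      constructor coords
      field equation : κ * x ≡ a * p + b * s

    combine : ∀ {κ x y a₀ b₀ a₁ b₁} r μ ν → Coords κ x a₀ b₀ → Coords (κ * r) y a₁ b₁ →
      Coords (κ * r) (μ * y - ν * x) (μ * a₁ - ν * r * a₀) (μ * b₁ - ν * r * b₀)
    combine {κ} {x} {y} {a₀} {b₀} {a₁} {b₁} r μ ν (coords κx) (coords κry) = coords (begin
      κ * r * (μ * y - ν * x)
        ≡⟨ solve 6 (λ κ r x y μ ν → κ :* r :* (μ :* y :- ν :* x) := μ :* (κ :* r :* y) :- ν :* r :* (κ :* x))
                 refl κ r x y μ ν ⟩
      μ * (κ * r * y) - ν * r * (κ * x)
        ≡⟨ cong₂ (λ u w → μ * u - ν * r * w) κry κx ⟩
      μ * (a₁ * p + b₁ * s) - ν * r * (a₀ * p + b₀ * s)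
        ≡⟨ solve 9 (λ r a₀ b₀ a₁ b₁ μ ν p s →
                   μ :* (a₁ :* p :+ b₁ :* s) :- ν :* r :* (a₀ :* p :+ b₀ :* s)
                := (μ :* a₁ :- ν :* r :* a₀) :* p :+ (μ :* b₁ :- ν :* r :* b₀) :* s)
                 refl r a₀ b₀ a₁ b₁ μ ν p s ⟩
      (μ * a₁ - ν * r * a₀) * p + (μ * b₁ - ν * r * b₀) * s ∎)

    recurrence-step : ∀ {κ x y z a₀ b₀ a₁ b₁} r d a b →
      Coords κ x a₀ b₀ → Coords (κ * r) y a₁ b₁ → d * z ≡ a * y - b * x →
      Coords (κ * r * d) z (a * a₁ - b * r * a₀) (a * b₁ - b * r * b₀)
    recurrence-step {κ} {z = z} r d a b κx κry dz =
      coords (trans (*-assoc (κ * r) d z)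
                    (trans (cong (κ * r *_) dz) (Coords.equation (combine r a b κx κry))))

    turán-expansion : ∀ {κ x y z a₀ b₀ a₁ b₁ a₂ b₂} r d →
      Coords κ x a₀ b₀ → Coords (κ * r) y a₁ b₁ → Coords (κ * r * d) z a₂ b₂ →
      κ * r * (κ * r) * d * (y * y - x * z)
        ≡ quadratic (d * a₁ * a₁ - r * a₀ * a₂) (d * (a₁ * b₁ + b₁ * a₁) - r * (a₀ * b₂ + a₂ * b₀))
                    (d * b₁ * b₁ - r * b₀ * b₂) p s
    turán-expansion {κ} {x} {y} {z} {a₀} {b₀} {a₁} {b₁} {a₂} {b₂} r d
                    (coords κx) (coords κry) (coords κrdz) = begin
      κ * r * (κ * r) * d * (y * y - x * z)
        ≡⟨ solve 6 (λ κ r d x y z → κ :* r :* (κ :* r) :* d :* (y :* y :- x :* z)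
                                 := d :* (κ :* r :* y) :* (κ :* r :* y) :- r :* (κ :* x) :* (κ :* r :* d :* z))
                 refl κ r d x y z ⟩
      d * (κ * r * y) * (κ * r * y) - r * (κ * x) * (κ * r * d * z)
        ≡⟨ cong₂ (λ u w → d * u * u - r * (κ * x) * w) κry κrdz ⟩
      d * (a₁ * p + b₁ * s) * (a₁ * p + b₁ * s) - r * (κ * x) * (a₂ * p + b₂ * s)
        ≡⟨ cong (λ u → d * (a₁ * p + b₁ * s) * (a₁ * p + b₁ * s) - r * u * (a₂ * p + b₂ * s)) κx ⟩
      d * (a₁ * p + b₁ * s) * (a₁ * p + b₁ * s) - r * (a₀ * p + b₀ * s) * (a₂ * p + b₂ * s)
        ≡⟨ solve 10 (λ r d a₀ b₀ a₁ b₁ a₂ b₂ p s →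
                    d :* (a₁ :* p :+ b₁ :* s) :* (a₁ :* p :+ b₁ :* s)
                    :- r :* (a₀ :* p :+ b₀ :* s) :* (a₂ :* p :+ b₂ :* s)
                 := (d :* a₁ :* a₁ :- r :* a₀ :* a₂) :* p :* p
                    :+ (d :* (a₁ :* b₁ :+ b₁ :* a₁) :- r :* (a₀ :* b₂ :+ a₂ :* b₀)) :* p :* s
                    :+ (d :* b₁ :* b₁ :- r :* b₀ :* b₂) :* s :* s)
                  refl r d a₀ b₀ a₁ b₁ a₂ b₂ p s ⟩
      quadratic (d * a₁ * a₁ - r * a₀ * a₂) (d * (a₁ * b₁ + b₁ * a₁) - r * (a₀ * b₂ + a₂ * b₀))
                (d * b₁ * b₁ - r * b₀ * b₂) p s ∎

  -- The multipliers Kᵢ = κᵢ₊₁² rᵢ₊₁ of the three Turán expansions satisfy r₁ K₀ K₂ = r₃ K₁².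
  turán-multipliers : ∀ κ r₁ r₂ r₃ W₀ W₁ W₂ →
    r₁ * (κ * κ * r₁) * (κ * r₁ * r₂ * (κ * r₁ * r₂) * r₃) * (W₀ * W₂ - W₁ * W₁)
      ≡ r₁ * (κ * κ * r₁ * W₀ * (κ * r₁ * r₂ * (κ * r₁ * r₂) * r₃ * W₂))
        - r₃ * (κ * r₁ * (κ * r₁) * r₂ * W₁ * (κ * r₁ * (κ * r₁) * r₂ * W₁))
  turán-multipliers = solve 7 (λ κ r₁ r₂ r₃ W₀ W₁ W₂ →
       r₁ :* (κ :* κ :* r₁) :* (κ :* r₁ :* r₂ :* (κ :* r₁ :* r₂) :* r₃) :* (W₀ :* W₂ :- W₁ :* W₁)
    := r₁ :* (κ :* κ :* r₁ :* W₀ :* (κ :* r₁ :* r₂ :* (κ :* r₁ :* r₂) :* r₃ :* W₂))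
       :- r₃ :* (κ :* r₁ :* (κ :* r₁) :* r₂ :* W₁ :* (κ :* r₁ :* (κ :* r₁) :* r₂ :* W₁))) refl

  quartic-of-quadratics : ∀ u v α₀ β₀ γ₀ α₁ β₁ γ₁ α₂ β₂ γ₂ p s →
    u * (quadratic α₀ β₀ γ₀ p s * quadratic α₂ β₂ γ₂ p s) - v * (quadratic α₁ β₁ γ₁ p s * quadratic α₁ β₁ γ₁ p s)
      ≡ quartic (u * (α₀ * α₂) - v * (α₁ * α₁))
                (u * (α₀ * β₂ + β₀ * α₂) - v * (α₁ * β₁ + β₁ * α₁))
                (u * (α₀ * γ₂ + β₀ * β₂ + γ₀ * α₂) - v * (α₁ * γ₁ + β₁ * β₁ + γ₁ * α₁))
                (u * (β₀ * γ₂ + γ₀ * β₂) - v * (β₁ * γ₁ + γ₁ * β₁))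
                (u * (γ₀ * γ₂) - v * (γ₁ * γ₁)) p s
  quartic-of-quadratics = solve 13 (λ u v α₀ β₀ γ₀ α₁ β₁ γ₁ α₂ β₂ γ₂ p s →
       u :* ((α₀ :* p :* p :+ β₀ :* p :* s :+ γ₀ :* s :* s) :* (α₂ :* p :* p :+ β₂ :* p :* s :+ γ₂ :* s :* s))
       :- v :* ((α₁ :* p :* p :+ β₁ :* p :* s :+ γ₁ :* s :* s) :* (α₁ :* p :* p :+ β₁ :* p :* s :+ γ₁ :* s :* s))
    := (u :* (α₀ :* α₂) :- v :* (α₁ :* α₁)) :* (p :* p :* p :* p)
       :+ (u :* (α₀ :* β₂ :+ β₀ :* α₂) :- v :* (α₁ :* β₁ :+ β₁ :* α₁)) :* (p :* p :* p :* s)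
       :+ (u :* (α₀ :* γ₂ :+ β₀ :* β₂ :+ γ₀ :* α₂) :- v :* (α₁ :* γ₁ :+ β₁ :* β₁ :+ γ₁ :* α₁)) :* (p :* p :* s :* s)
       :+ (u :* (β₀ :* γ₂ :+ γ₀ :* β₂) :- v :* (β₁ :* γ₁ :+ γ₁ :* β₁)) :* (p :* s :* s :* s)
       :+ (u :* (γ₀ :* γ₂) :- v :* (γ₁ :* γ₁)) :* (s :* s :* s :* s)) refl

  quartic-pos : ∀ {f₀ f₁ f₂ f₃ f₄ p s} → 0ℚ < f₀ → 0ℚ ≤ f₁ → 0ℚ ≤ f₂ → 0ℚ ≤ f₃ → 0ℚ ≤ f₄ →
    0ℚ < p → 0ℚ ≤ s → 0ℚ < quartic f₀ f₁ f₂ f₃ f₄ p s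
  quartic-pos 0<f₀ 0≤f₁ 0≤f₂ 0≤f₃ 0≤f₄ 0<p 0≤s =
    +-mono-<-≤ (+-mono-<-≤ (+-mono-<-≤ (+-mono-<-≤
      (*-pos 0<f₀ (*-pos (*-pos (*-pos 0<p 0<p) 0<p) 0<p))
      (*-nonNeg 0≤f₁ (*-nonNeg (*-nonNeg (*-nonNeg 0≤p 0≤p) 0≤p) 0≤s)))
      (*-nonNeg 0≤f₂ (*-nonNeg (*-nonNeg (*-nonNeg 0≤p 0≤p) 0≤s) 0≤s)))
      (*-nonNeg 0≤f₃ (*-nonNeg (*-nonNeg (*-nonNeg 0≤p 0≤s) 0≤s) 0≤s)))
      (*-nonNeg 0≤f₄ (*-nonNeg (*-nonNeg (*-nonNeg 0≤s 0≤s) 0≤s) 0≤s))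
    where 0≤p = <⇒≤ 0<p

  ratioₑ : ℕ → Expr
  ratioₑ zero    = Mₑ 0
  ratioₑ (suc i) = Dₑ i

  κₑ : ℕ → Expr
  κₑ zero    = lit 1
  κₑ (suc i) = κₑ i ⊗ ratioₑ i

  scaled : Expr → Expr → ℕ → Expr
  scaled x₀ x₁ zero          = x₀
  scaled x₀ x₁ (suc zero)    = x₁
  scaled x₀ x₁ (suc (suc i)) = Aₑ i ⊗ scaled x₀ x₁ (suc i) ⊖ Bₑ i ⊗ ratioₑ i ⊗ scaled x₀ x₁ i

  pₑ sₑ : ℕ → Expr
  pₑ = scaled (lit 1) (Lₑ 0)
  sₑ = scaled (lit 0) (lit 1)

  Kₑ αₑ βₑ γₑ : ℕ → Expr
  Kₑ i = κₑ (suc i) ⊗ κₑ (suc i) ⊗ ratioₑ (suc i)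
  αₑ i = ratioₑ (suc i) ⊗ pₑ (suc i) ⊗ pₑ (suc i) ⊖ ratioₑ i ⊗ pₑ i ⊗ pₑ (2 ℕ.+ i)
  βₑ i = ratioₑ (suc i) ⊗ (pₑ (suc i) ⊗ sₑ (suc i) ⊕ sₑ (suc i) ⊗ pₑ (suc i))
         ⊖ ratioₑ i ⊗ (pₑ i ⊗ sₑ (2 ℕ.+ i) ⊕ pₑ (2 ℕ.+ i) ⊗ sₑ i)
  γₑ i = ratioₑ (suc i) ⊗ sₑ (suc i) ⊗ sₑ (suc i) ⊖ ratioₑ i ⊗ sₑ i ⊗ sₑ (2 ℕ.+ i)

  Cₑ f₀ₑ f₁ₑ f₂ₑ f₃ₑ f₄ₑ gᵖₑ gˢₑ : Expr
  Cₑ  = ratioₑ 1 ⊗ Kₑ 0 ⊗ Kₑ 2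
  f₀ₑ = ratioₑ 1 ⊗ (αₑ 0 ⊗ αₑ 2) ⊖ ratioₑ 3 ⊗ (αₑ 1 ⊗ αₑ 1)
  f₁ₑ = ratioₑ 1 ⊗ (αₑ 0 ⊗ βₑ 2 ⊕ βₑ 0 ⊗ αₑ 2) ⊖ ratioₑ 3 ⊗ (αₑ 1 ⊗ βₑ 1 ⊕ βₑ 1 ⊗ αₑ 1)
  f₂ₑ = ratioₑ 1 ⊗ (αₑ 0 ⊗ γₑ 2 ⊕ βₑ 0 ⊗ βₑ 2 ⊕ γₑ 0 ⊗ αₑ 2)
        ⊖ ratioₑ 3 ⊗ (αₑ 1 ⊗ γₑ 1 ⊕ βₑ 1 ⊗ βₑ 1 ⊕ γₑ 1 ⊗ αₑ 1)
  f₃ₑ = ratioₑ 1 ⊗ (βₑ 0 ⊗ γₑ 2 ⊕ γₑ 0 ⊗ βₑ 2) ⊖ ratioₑ 3 ⊗ (βₑ 1 ⊗ γₑ 1 ⊕ γₑ 1 ⊗ βₑ 1)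
  f₄ₑ = ratioₑ 1 ⊗ (γₑ 0 ⊗ γₑ 2) ⊖ ratioₑ 3 ⊗ (γₑ 1 ⊗ γₑ 1)
  gᵖₑ = Mₑ 1 ⊗ pₑ 2 ⊖ Lₑ 1 ⊗ ratioₑ 1 ⊗ pₑ 1
  gˢₑ = Mₑ 1 ⊗ sₑ 2 ⊖ Lₑ 1 ⊗ ratioₑ 1 ⊗ sₑ 1

  Δ : ℕ → ℚ
  Δ k = V (suc k) * V (suc k) - V k * V (suc (suc k))

  RatioBound : ℕ → Set
  RatioBound k = 0ℚ < V k × L k * V k ≤ M k * V (suc k)

  module Tail (k : ℕ) (7≤k : 7 ℕ.≤ k) (bound : RatioBound k) where

    ⟪_⟫ : Expr → ℚ
    ⟪ e ⟫ = ⟦ e ⟧ k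

    p s : ℚ
    p = V k
    s = M k * V (suc k) - L k * V k

    0<p : 0ℚ < p
    0<p = proj₁ bound

    0≤s : 0ℚ ≤ s
    0≤s = p≤q⇒0≤q-p (proj₂ bound)

    open Coordinates p s

    coordinates : ∀ i → Coords ⟪ κₑ i ⟫ (V (i ℕ.+ k)) ⟪ pₑ i ⟫ ⟪ sₑ i ⟫
    coordinates zero =
      coords (solve 2 (λ p s → con (ι 1) :* p := con (ι 1) :* p :+ con (ι 0) :* s) refl p s)
    coordinates (suc zero) =
      coords (solve 4 (λ m q l p → con (ι 1) :* m :* q := l :* p :+ con (ι 1) :* (m :* q :- l :* p))
                      refl (M k) (V (suc k)) (L k) p)
    coordinates (suc (suc i)) =
      recurrence-step ⟪ ratioₑ i ⟫ (D (i ℕ.+ k)) (A (i ℕ.+ k)) (B (i ℕ.+ k))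
                      (coordinates i) (coordinates (suc i)) (recurrence (i ℕ.+ k))

    turán : ∀ i → ⟪ Kₑ i ⟫ * Δ (i ℕ.+ k) ≡ quadratic ⟪ αₑ i ⟫ ⟪ βₑ i ⟫ ⟪ γₑ i ⟫ p s
    turán i = turán-expansion ⟪ ratioₑ i ⟫ ⟪ ratioₑ (suc i) ⟫
                              (coordinates i) (coordinates (suc i)) (coordinates (2 ℕ.+ i))

    nonNeg : ∀ e → NonNegCoeffsFrom 7 e → 0ℚ ≤ ⟪ e ⟫
    nonNeg e ok = nonNeg-by-coeffs 7 e ok 7≤k

    pos : ∀ e → NonNegCoeffsFrom 7 (e ⊖ lit 1) → 0ℚ < ⟪ e ⟫
    pos e ok = pos-by-coeffs 7 e ok 7≤k

    ratio-bound-step : RatioBound (suc k)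
    ratio-bound-step =
      0<q , 0≤q-p⇒p≤q (*-cancelˡ-nonNeg (pos (κₑ 2) _) (subst (0ℚ ≤_) (sym growth) 0≤g))
      where
      0<q : 0ℚ < V (suc k)
      0<q = *-cancelˡ-pos (pos (Mₑ 0) _) (<-≤-trans (*-pos (pos (Lₑ 0) _) 0<p) (proj₂ bound))
      growth : ⟪ κₑ 2 ⟫ * (M (suc k) * V (2 ℕ.+ k) - L (suc k) * V (suc k)) ≡ ⟪ gᵖₑ ⟫ * p + ⟪ gˢₑ ⟫ * s
      growth = Coords.equation
                 (combine ⟪ ratioₑ 1 ⟫ (M (suc k)) (L (suc k)) (coordinates 1) (coordinates 2))
      0≤g : 0ℚ ≤ ⟪ gᵖₑ ⟫ * p + ⟪ gˢₑ ⟫ * s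
      0≤g = +-mono-≤ (*-nonNeg (nonNeg gᵖₑ _) (<⇒≤ 0<p)) (*-nonNeg (nonNeg gˢₑ _) 0≤s)

    Δ-log-convex : Δ (suc k) * Δ (suc k) < Δ k * Δ (2 ℕ.+ k)
    Δ-log-convex = 0<q-p⇒p<q (*-cancelˡ-pos (pos Cₑ _) (subst (0ℚ <_) (sym expansion) 0<quartic))
      where
      expansion : ⟪ Cₑ ⟫ * (Δ k * Δ (2 ℕ.+ k) - Δ (suc k) * Δ (suc k))
                ≡ quartic ⟪ f₀ₑ ⟫ ⟪ f₁ₑ ⟫ ⟪ f₂ₑ ⟫ ⟪ f₃ₑ ⟫ ⟪ f₄ₑ ⟫ p s
      expansion =
        trans (turán-multipliers ⟪ κₑ 1 ⟫ ⟪ ratioₑ 1 ⟫ ⟪ ratioₑ 2 ⟫ ⟪ ratioₑ 3 ⟫ (Δ k) (Δ (suc k)) (Δ (2 ℕ.+ k)))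
        (trans (cong₂ (λ u w → ⟪ ratioₑ 1 ⟫ * u - ⟪ ratioₑ 3 ⟫ * w)
                      (cong₂ _*_ (turán 0) (turán 2)) (cong₂ _*_ (turán 1) (turán 1)))
               (quartic-of-quadratics ⟪ ratioₑ 1 ⟫ ⟪ ratioₑ 3 ⟫ ⟪ αₑ 0 ⟫ ⟪ βₑ 0 ⟫ ⟪ γₑ 0 ⟫
                  ⟪ αₑ 1 ⟫ ⟪ βₑ 1 ⟫ ⟪ γₑ 1 ⟫ ⟪ αₑ 2 ⟫ ⟪ βₑ 2 ⟫ ⟪ γₑ 2 ⟫ p s))
      0<quartic : 0ℚ < quartic ⟪ f₀ₑ ⟫ ⟪ f₁ₑ ⟫ ⟪ f₂ₑ ⟫ ⟪ f₃ₑ ⟫ ⟪ f₄ₑ ⟫ p s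
      0<quartic =
        quartic-pos (pos f₀ₑ _) (nonNeg f₁ₑ _) (nonNeg f₂ₑ _) (nonNeg f₃ₑ _) (nonNeg f₄ₑ _) 0<p 0≤s

  ratio-bound : ∀ j → RatioBound (7 ℕ.+ j)
  ratio-bound zero    = toWitness {a? = 0ℚ <? V 7} _ , toWitness {a? = L 7 * V 7 ≤? M 7 * V 8} _
  ratio-bound (suc j) = Tail.ratio-bound-step (7 ℕ.+ j) (ℕ.m≤m+n 7 j) (ratio-bound j)

  Δ-log-convex : ∀ k → 1 ℕ.≤ k → Δ (suc k) * Δ (suc k) < Δ k * Δ (suc (suc k))
  Δ-log-convex 1 _ = toWitness {a? = _ <? _} _
  Δ-log-convex 2 _ = toWitness {a? = _ <? _} _
  Δ-log-convex 3 _ = toWitness {a? = _ <? _} _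
  Δ-log-convex 4 _ = toWitness {a? = _ <? _} _
  Δ-log-convex 5 _ = toWitness {a? = _ <? _} _
  Δ-log-convex 6 _ = toWitness {a? = _ <? _} _
  Δ-log-convex (suc (suc (suc (suc (suc (suc (suc j))))))) _ =
    Tail.Δ-log-convex (7 ℕ.+ j) (ℕ.m≤m+n 7 j) (ratio-bound j)

open FennesseyLarcombeFrench using (Δ; Δ-log-convex)

open import Data.Nat using (ℕ; _≤_; _∸_; _+_; suc; s≤s)
open import Data.Nat.Properties using (+-comm)
open import Relation.Binary.PropositionalEquality using (subst₂)
open import Data.Rational using (_*_; _-_; _<_)

theorem1p1 : (n : ℕ) → 3 ≤ n →
    (V n * V n - V (n ∸ 1) * V (n + 1)) * (V n * V n - V (n ∸ 1) * V (n + 1))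
      < (V (n ∸ 1) * V (n ∸ 1) - V (n ∸ 2) * V n)
        * (V (n + 1) * V (n + 1) - V n * V (n + 2))
theorem1p1 n@(suc (suc k)) (s≤s (s≤s 1≤k)) =
  subst₂ (λ n+1 n+2 → (V n * V n - V (suc k) * V n+1) * (V n * V n - V (suc k) * V n+1)
                        < Δ k * (V n+1 * V n+1 - V n * V n+2))
         (+-comm 1 n) (+-comm 2 n) (Δ-log-convex k 1≤k)
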